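{- (1) For every $n\ge 9$ the game $\langle K_{1,n},h_{2,22},g_2\rangle$ is winning. (2) For all positive integers $s,H$ and every $n\ge \mathrm{PHFN}(H,s+1,s+1)$, the game $\langle K_{1,n},h_{s,H},g_s\rangle$ is winning.
   Context: $K_{1,n}$ is the star with center $A$ and $n$ leaves. The functions on its vertices are: - $h_{s,H}(v)=s+1$ for $v\ne A$, and $h_{s,H}(A)=H$; - $g_s(v)=1$ for $v\ne A$, and $g_s(A)=s$. A perfect hash family $\mathrm{PHF}(N;k,v,t)$ is an $N\times k$ array with entries from $v$ symbols such that in every $N\times t$ subarray at least one row consists of distinct symbols. $\mathrm{PHFN}(k,v,t)$ is the smallest $N$ for which a $\mathrm{PHF}(N;k,v,t)$ exists. Hat guessing game $\langle G,h,g\rangle$: $G=(V,E)$ is a finite graph and $h,g\colon V\to\mathbb N$. The adversary gives each vertex $v$ a color in $\{0,\dots,h(v)-1\}$. Each vertex sees only its neighbors' colors and names at most $g(v)$ colors via a deterministic strategy fixed in advance that depends only on those colors. The game is winning if some strategy ensures that for every assignment some vertex names its own color. -}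

module Defs where

open import Data.Nat using (ℕ; zero; suc; _≤_; _<_)
open import Data.Fin using (Fin; zero; suc)
open import Data.List using (List; length)
open import Data.List.Membership.Propositional using (_∈_)
open import Data.Product using (Σ; ∃; _×_)
open import Data.Unit using (⊤)
open import Data.Empty using (⊥)
open import Relation.Nullary using (¬_)
open import Relation.Binary.PropositionalEquality using (_≡_)
open import Function.Definitions using (Injective)

record Graph : Set₁ where
  field
    size : ℕ
    Adj  : Fin size → Fin size → Set

open Graph public

Coloring : (G : Graph) → (Fin (size G) → ℕ) → Set
Coloring G h = (v : Fin (size G)) → Fin (h v)

record Strategy (G : Graph) (h g : Fin (size G) → ℕ) : Set where
  field
    guess    : (v : Fin (size G)) → Coloring G h → List (Fin (h v))
    bounded  : ∀ v c → length (guess v c) ≤ g v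
    local    : ∀ v (c c′ : Coloring G h) →
               (∀ u → Adj G v u → c u ≡ c′ u) → guess v c ≡ guess v c′

Winning : (G : Graph) → (h g : Fin (size G) → ℕ) → Set
Winning G h g = Σ (Strategy G h g) λ σ →
  (c : Coloring G h) → ∃ λ v → c v ∈ Strategy.guess σ v c

-- The star K_{1,n}: vertex set Fin (suc n), centre A = zero, leaves suc i.
StarAdj : ∀ {n} → Fin (suc n) → Fin (suc n) → Set
StarAdj zero    zero    = ⊥
StarAdj zero    (suc _) = ⊤
StarAdj (suc _) zero    = ⊤
StarAdj (suc _) (suc _) = ⊥

K1 : ℕ → Graph
K1 n = record { size = suc n ; Adj = StarAdj }

hStar : (n s H : ℕ) → Fin (suc n) → ℕ
hStar n s H zero    = H
hStar n s H (suc _) = suc s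

gStar : (n s : ℕ) → Fin (suc n) → ℕ
gStar n s zero    = s
gStar n s (suc _) = 1

IsPHF : (N k v t : ℕ) → (Fin N → Fin k → Fin v) → Set
IsPHF N k v t A =
  (cols : Fin t → Fin k) → Injective _≡_ _≡_ cols →
  ∃ λ (r : Fin N) → Injective _≡_ _≡_ (λ j → A r (cols j))

PHFExists : (N k v t : ℕ) → Set
PHFExists N k v t = Σ (Fin N → Fin k → Fin v) (IsPHF N k v t)

IsPHFN : (k v t N : ℕ) → Set
IsPHFN k v t N = PHFExists N k v t × (∀ N′ → N′ < N → ¬ PHFExists N′ k v t)

-- Adding constant rows to a PHF(N; H, s+1, s+1) keeps it a PHF, so we may take one
-- with a row for every leaf. Leaf r guesses the entry of row r in column c(A), and
-- A guesses every colour a whose column disagrees with the leaf colours in every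
-- row: if c(A) is not among them, some leaf is right. A guesses at most s colours,
-- for among s+1 of them some row would be injective on their columns, hence a
-- bijection onto the s+1 colours, and so it would meet the colour of its leaf.
-- Part (1) uses an explicit PHF(9; 22, 3, 3), verified by computation.
module Submission where

open import Defs
open import Data.Nat using (ℕ; zero; suc; _≤_; _<_; _<?_; z≤n; s≤s)
open import Data.Nat.Properties using (≮⇒≥; n<1+n)
open import Data.Fin using (Fin; zero; suc; toℕ; fromℕ<; inject≤; punchOut)
open import Data.Fin.Properties
  using (_≟_; all?; any?; toℕ<n; toℕ-injective; toℕ-fromℕ<; toℕ-inject≤;
         inject≤-injective; punchOut-injective; pigeonhole; <⇒≢)
open import Data.List using (List; []; _∷_; length; filter; allFin; lookup)
open import Data.List.Membership.Propositional using (_∈_)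
open import Data.List.Membership.Propositional.Properties
  using (∈-filter⁺; ∈-filter⁻; ∈-allFin; ∈-lookup)
open import Data.List.Relation.Unary.Any using (here)
import Data.List.Relation.Unary.All as All
open import Data.List.Relation.Unary.Unique.Propositional using (Unique; _∷_)
open import Data.List.Relation.Unary.Unique.Propositional.Properties using (filter⁺; allFin⁺)
open import Data.Vec as Vec using (Vec; []; _∷_; tabulate)
open import Data.Vec.Properties using (tabulate-cong; lookup∘tabulate)
import Data.Vec.Functional as Fun
open import Data.Product using (∃; _×_; _,_; proj₂)
open import Function using (_∘_)
open import Level using (0ℓ)
open import Data.Bool using (true)
open import Function.Definitions using (Injective)
open import Relation.Nullary using (¬_; Dec; does; yes; no; ¬?; map′; contradiction)
open import Relation.Nullary.Decidable using (_→-dec_)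
open import Relation.Unary using (Pred; Decidable)
open import Relation.Binary.Definitions using (_Respects_)
open import Relation.Binary.PropositionalEquality
  using (_≡_; _≢_; refl; sym; trans; cong; subst; _≗_)

private variable
  m k t v N N′ : ℕ

Injective-resp-≗ : {A B : Set} {f g : A → B} →
                   f ≗ g → Injective _≡_ _≡_ f → Injective _≡_ _≡_ g
Injective-resp-≗ {f = f} {g} f≗g f-inj {x} {y} gx≡gy =
  f-inj (trans (f≗g x) (trans gx≡gy (sym (f≗g y))))

injective? : (f : Fin m → Fin k) → Dec (Injective _≡_ _≡_ f)
injective? f = map′ (λ inj {i} {j} → inj i j) (λ inj i j → inj)
  (all? λ i → all? λ j → (f i ≟ f j) →-dec (i ≟ j))

all-functions? : {P : Pred (Fin t → Fin k) 0ℓ} → P Respects _≗_ →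
                 Decidable P → Dec (∀ f → P f)
all-functions? {zero} resp P? = map′ (λ p f → resp (λ ()) p) (λ ∀P → ∀P _) (P? (λ ()))
all-functions? {suc t} resp P? =
  map′ (λ ∀P f → resp (λ { zero → refl ; (suc i) → refl }) (∀P (f zero) (f ∘ suc)))
       (λ ∀P x g → ∀P (x Fun.∷ g))
       (all? λ x → all-functions? (λ g≗g′ → resp (λ { zero → refl ; (suc i) → g≗g′ i }))
                                  (λ g → P? (x Fun.∷ g)))

injective⇒hits : (f : Fin (suc m) → Fin (suc m)) → Injective _≡_ _≡_ f →
                 ∀ y → ¬ (∀ i → f i ≢ y)
injective⇒hits {m} f f-inj y misses
  with i , j , i<j , same ← pigeonhole (n<1+n m) (λ i → punchOut (misses i ∘ sym))
  = <⇒≢ i<j (f-inj (punchOut-injective (misses i ∘ sym) (misses j ∘ sym) same))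

Unique⇒lookup-injective : {A : Set} {xs : List A} → Unique xs → Injective _≡_ _≡_ (lookup xs)
Unique⇒lookup-injective (_ ∷ _)     {zero}  {zero}  _  = refl
Unique⇒lookup-injective (x∉xs ∷ _)  {zero}  {suc j} eq = contradiction eq (All.lookup x∉xs (∈-lookup j))
Unique⇒lookup-injective (x∉xs ∷ _)  {suc i} {zero}  eq = contradiction (sym eq) (All.lookup x∉xs (∈-lookup i))
Unique⇒lookup-injective (_ ∷ uniq) {suc i} {suc j} eq = cong suc (Unique⇒lookup-injective uniq eq)

length-filter-allFin≤ : {P : Pred (Fin k) 0ℓ} (P? : Decidable P) →
  (∀ (f : Fin (suc m) → Fin k) → Injective _≡_ _≡_ f → ¬ (∀ j → P (f j))) →
  length (filter P? (allFin k)) ≤ m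
length-filter-allFin≤ {k} P? no-injection = ≮⇒≥ λ m<len →
  let embed j = inject≤ j m<len in
  no-injection (lookup xs ∘ embed)
    (inject≤-injective _ _ _ _ ∘ Unique⇒lookup-injective (filter⁺ P? (allFin⁺ k)))
    (λ j → proj₂ (∈-filter⁻ P? {xs = allFin k} (∈-lookup {xs = xs} (embed j))))
  where xs = filter P? (allFin k)

dec-true⁻¹ : {P : Set} (p? : Dec P) → does p? ≡ true → P
dec-true⁻¹ (yes p) _  = p
dec-true⁻¹ (no _)  ()

isPHF? : ∀ N k v t A → Dec (IsPHF N k v t A)
isPHF? N k v t A =
  all-functions? resp (λ cols → injective? cols →-dec any? λ r → injective? (A r ∘ cols))
  where
  resp : (λ cols → Injective _≡_ _≡_ cols → ∃ λ r → Injective _≡_ _≡_ (A r ∘ cols)) Respects _≗_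
  resp f≗g phf-f g-inj with r , row-inj ← phf-f (Injective-resp-≗ (sym ∘ f≗g) g-inj)
    = r , Injective-resp-≗ (cong (A r) ∘ f≗g) row-inj

padRows : (Fin N → Fin k → Fin (suc v)) → Fin N′ → Fin k → Fin (suc v)
padRows {N} A i with toℕ i <? N
... | yes i<N = A (fromℕ< i<N)
... | no _    = λ _ → zero

padRows-inject≤ : (A : Fin N → Fin k → Fin (suc v)) (N≤N′ : N ≤ N′) →
                  ∀ r → padRows {N′ = N′} A (inject≤ r N≤N′) ≡ A r
padRows-inject≤ {N} A N≤N′ r with toℕ (inject≤ r N≤N′) <? N
... | yes r<N = cong A (toℕ-injective (trans (toℕ-fromℕ< r<N) (toℕ-inject≤ r N≤N′)))
... | no  r≮N = contradiction (subst (_< N) (sym (toℕ-inject≤ r N≤N′)) (toℕ<n r)) r≮N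

PHFExists-mono : N ≤ N′ → PHFExists N k (suc v) t → PHFExists N′ k (suc v) t
PHFExists-mono N≤N′ (A , phf) = padRows A , λ cols cols-inj →
  let r , row-inj = phf cols cols-inj in
  inject≤ r N≤N′ , subst (λ row → Injective _≡_ _≡_ (row ∘ cols))
                         (sym (padRows-inject≤ A N≤N′ r)) row-inj

module StarStrategy {n s H : ℕ} (A : Fin n → Fin H → Fin (suc s))
                    (phf : IsPHF n H (suc s) (suc s) A) where

  -- The leaf colours are passed to the centre as a vector, so that its guess is
  -- local without function extensionality.
  LeafColours : Set
  LeafColours = Vec (Fin (suc s)) n

  leafColours : Coloring (K1 n) (hStar n s H) → LeafColours
  leafColours c = tabulate (c ∘ suc)

  Unhit : LeafColours → Fin H → Set
  Unhit x a = ∀ r → A r a ≢ Vec.lookup x r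

  unhit? : ∀ x → Decidable (Unhit x)
  unhit? x a = all? λ r → ¬? (A r a ≟ Vec.lookup x r)

  unhitColours : LeafColours → List (Fin H)
  unhitColours x = filter (unhit? x) (allFin H)

  length-unhitColours≤ : ∀ x → length (unhitColours x) ≤ s
  length-unhitColours≤ x = length-filter-allFin≤ (unhit? x) λ cols cols-inj all-unhit →
    let r , row-inj = phf cols cols-inj in
    injective⇒hits (A r ∘ cols) row-inj (Vec.lookup x r) (λ j → all-unhit j r)

  guess : (u : Fin (suc n)) → Coloring (K1 n) (hStar n s H) → List (Fin (hStar n s H u))
  guess zero    c = unhitColours (leafColours c)
  guess (suc r) c = A r (c zero) ∷ []

  strategy : Strategy (K1 n) (hStar n s H) (gStar n s)
  strategy = record { guess = guess ; bounded = bounded ; local = local }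
    where
    bounded : ∀ u c → length (guess u c) ≤ gStar n s u
    bounded zero    c = length-unhitColours≤ (leafColours c)
    bounded (suc r) c = s≤s z≤n

    local : ∀ u (c c′ : Coloring (K1 n) (hStar n s H)) →
            (∀ w → Adj (K1 n) u w → c w ≡ c′ w) → guess u c ≡ guess u c′
    local zero    c c′ same = cong unhitColours (tabulate-cong (λ r → same (suc r) _))
    local (suc r) c c′ same = cong (λ a → A r a ∷ []) (same zero _)

  wins : (c : Coloring (K1 n) (hStar n s H)) → ∃ λ u → c u ∈ guess u c
  wins c with any? (λ r → A r (c zero) ≟ Vec.lookup (leafColours c) r)
  ... | yes (r , hit) = suc r , here (sym (trans hit (lookup∘tabulate (c ∘ suc) r)))
  ... | no  no-hit    = zero , ∈-filter⁺ (unhit? (leafColours c)) (∈-allFin (c zero))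
                                          (λ r hit → no-hit (r , hit))

  winning : Winning (K1 n) (hStar n s H) (gStar n s)
  winning = strategy , wins

PHF⇒winning : ∀ {n s H} → PHFExists n H (suc s) (suc s) →
              Winning (K1 n) (hStar n s H) (gStar n s)
PHF⇒winning (A , phf) = StarStrategy.winning A phf

₀ ₁ ₂ : Fin 3
₀ = zero
₁ = suc zero
₂ = suc (suc zero)

table-9-22-3 : Vec (Vec (Fin 3) 22) 9
table-9-22-3 =
  (₀ ∷ ₀ ∷ ₁ ∷ ₀ ∷ ₁ ∷ ₀ ∷ ₀ ∷ ₀ ∷ ₂ ∷ ₂ ∷ ₂ ∷ ₁ ∷ ₁ ∷ ₂ ∷ ₀ ∷ ₁ ∷ ₁ ∷ ₂ ∷ ₁ ∷ ₂ ∷ ₂ ∷ ₂ ∷ []) ∷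
  (₀ ∷ ₀ ∷ ₁ ∷ ₂ ∷ ₁ ∷ ₁ ∷ ₂ ∷ ₀ ∷ ₀ ∷ ₂ ∷ ₁ ∷ ₀ ∷ ₀ ∷ ₁ ∷ ₂ ∷ ₂ ∷ ₁ ∷ ₂ ∷ ₀ ∷ ₁ ∷ ₀ ∷ ₁ ∷ []) ∷
  (₂ ∷ ₂ ∷ ₀ ∷ ₀ ∷ ₁ ∷ ₁ ∷ ₀ ∷ ₀ ∷ ₀ ∷ ₁ ∷ ₀ ∷ ₂ ∷ ₁ ∷ ₂ ∷ ₂ ∷ ₂ ∷ ₂ ∷ ₀ ∷ ₁ ∷ ₂ ∷ ₁ ∷ ₁ ∷ []) ∷
  (₁ ∷ ₁ ∷ ₁ ∷ ₀ ∷ ₀ ∷ ₂ ∷ ₂ ∷ ₀ ∷ ₀ ∷ ₁ ∷ ₂ ∷ ₁ ∷ ₀ ∷ ₀ ∷ ₁ ∷ ₂ ∷ ₂ ∷ ₂ ∷ ₂ ∷ ₀ ∷ ₁ ∷ ₁ ∷ []) ∷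
  (₂ ∷ ₂ ∷ ₀ ∷ ₂ ∷ ₂ ∷ ₂ ∷ ₁ ∷ ₁ ∷ ₀ ∷ ₁ ∷ ₁ ∷ ₀ ∷ ₀ ∷ ₀ ∷ ₂ ∷ ₀ ∷ ₁ ∷ ₀ ∷ ₁ ∷ ₁ ∷ ₀ ∷ ₂ ∷ []) ∷
  (₁ ∷ ₂ ∷ ₀ ∷ ₁ ∷ ₂ ∷ ₀ ∷ ₀ ∷ ₁ ∷ ₁ ∷ ₁ ∷ ₂ ∷ ₂ ∷ ₂ ∷ ₀ ∷ ₂ ∷ ₁ ∷ ₁ ∷ ₂ ∷ ₀ ∷ ₀ ∷ ₁ ∷ ₁ ∷ []) ∷
  (₀ ∷ ₂ ∷ ₀ ∷ ₁ ∷ ₀ ∷ ₁ ∷ ₀ ∷ ₀ ∷ ₂ ∷ ₂ ∷ ₀ ∷ ₂ ∷ ₁ ∷ ₁ ∷ ₁ ∷ ₁ ∷ ₀ ∷ ₁ ∷ ₂ ∷ ₂ ∷ ₀ ∷ ₁ ∷ []) ∷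
  (₂ ∷ ₁ ∷ ₀ ∷ ₁ ∷ ₀ ∷ ₀ ∷ ₂ ∷ ₀ ∷ ₂ ∷ ₀ ∷ ₁ ∷ ₂ ∷ ₁ ∷ ₀ ∷ ₀ ∷ ₁ ∷ ₀ ∷ ₂ ∷ ₂ ∷ ₁ ∷ ₁ ∷ ₂ ∷ []) ∷
  (₀ ∷ ₂ ∷ ₁ ∷ ₀ ∷ ₂ ∷ ₁ ∷ ₀ ∷ ₂ ∷ ₁ ∷ ₀ ∷ ₁ ∷ ₁ ∷ ₀ ∷ ₁ ∷ ₁ ∷ ₀ ∷ ₂ ∷ ₂ ∷ ₁ ∷ ₂ ∷ ₁ ∷ ₂ ∷ []) ∷ []

phf-array-9-22-3 : Fin 9 → Fin 22 → Fin 3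
phf-array-9-22-3 r = Vec.lookup (Vec.lookup table-9-22-3 r)

-- Stated as an equation on `does`: reducing `True (isPHF? …)` instead, as
-- `from-yes` or `toWitness` would, exhausts memory.
isPHF?-9-22-3-3 : does (isPHF? 9 22 3 3 phf-array-9-22-3) ≡ true
isPHF?-9-22-3-3 = refl

phf-9-22-3-3 : PHFExists 9 22 3 3
phf-9-22-3-3 = phf-array-9-22-3 , dec-true⁻¹ (isPHF? 9 22 3 3 phf-array-9-22-3) isPHF?-9-22-3-3

corollary3p7 : ((n : ℕ) → 9 ≤ n → Winning (K1 n) (hStar n 2 22) (gStar n 2))
    × ((s H : ℕ) → 1 ≤ s → 1 ≤ H → (N : ℕ) → IsPHFN H (suc s) (suc s) N →
    (n : ℕ) → N ≤ n → Winning (K1 n) (hStar n s H) (gStar n s))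
corollary3p7 =
  (λ n 9≤n → PHF⇒winning (PHFExists-mono 9≤n phf-9-22-3-3)) ,
  (λ s H _ _ N (phf-N , _) n N≤n → PHF⇒winning (PHFExists-mono N≤n phf-N))
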